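{- For every $\varepsilon>0$ there exists $q_0$ such that for every finite projective plane $\Pi_q$ of order $q\ge q_0$, the partition dimension of its incidence graph satisfies $\mathrm{pd}(G(\Pi_q))\ge (2-\varepsilon)\log_2 q$. In other words, $\mathrm{pd}(G(\Pi_q))\ge (2+o(1))\log_2 q$ as $q\to\infty$.
   Context: For a projective plane $\Pi_q$ with point set $\mathcal P$ and line set $\mathcal L$, its incidence graph $G(\Pi_q)$ is the bipartite graph on $\mathcal P\cup\mathcal L$ in which a point and a line are adjacent iff they are incident. For a connected graph $G$, $d(u,v)$ is the length of a shortest $u$–$v$ path, and for $S\subseteq V(G)$, $d(v,S)=\min_{s\in S} d(v,s)$. For an ordered partition $\mathbf S=\{S_1,\dots,S_k\}$ of $V(G)$, the representation of $v$ is $r(v\mid\mathbf S)=(d(v,S_1),\dots,d(v,S_k))$; $\mathbf S$ is a resolving partition if the vectors $r(v\mid \mathbf S)$, $v\in V(G)$, are pairwise distinct. The partition dimension $\mathrm{pd}(G)$ is the minimum $k$ for which a resolving $k$-partition of $V(G)$ exists. -}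

module Defs where

open import Data.Nat using (ℕ; zero; suc; _≤_; _<_)
open import Data.Fin using (Fin)
open import Data.Bool using (Bool; true; false)
open import Data.List using (List; length; filterᵇ)
open import Data.List.Base using ()
open import Data.Fin.Base using ()
open import Data.Sum using (_⊎_; inj₁; inj₂)
open import Data.Product using (Σ; _×_; _,_; ∃)
open import Function using (_∘_)
open import Function.Definitions using (Injective; Surjective)
open import Relation.Binary.PropositionalEquality using (_≡_; _≢_)
open import Relation.Nullary using (¬_)
open import Data.List using (allFin)

record ProjectivePlane : Set where
  field
    nP nL : ℕ
    I     : Fin nP → Fin nL → Bool
    line-through : ∀ (p p′ : Fin nP) → p ≢ p′ →
      Σ (Fin nL) λ ℓ → (I p ℓ ≡ true × I p′ ℓ ≡ true) ×
        (∀ ℓ′ → I p ℓ′ ≡ true → I p′ ℓ′ ≡ true → ℓ′ ≡ ℓ)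
    meet : ∀ (ℓ ℓ′ : Fin nL) → ℓ ≢ ℓ′ →
      Σ (Fin nP) λ p → (I p ℓ ≡ true × I p ℓ′ ≡ true) ×
        (∀ p′ → I p′ ℓ ≡ true → I p′ ℓ′ ≡ true → p′ ≡ p)
    quad     : Fin 4 → Fin nP
    quad-inj : Injective _≡_ _≡_ quad
    quad-gen : ∀ (i j k : Fin 4) → i ≢ j → j ≢ k → i ≢ k →
      ¬ (Σ (Fin nL) λ ℓ → I (quad i) ℓ ≡ true × I (quad j) ℓ ≡ true × I (quad k) ℓ ≡ true)

  pointsOn : Fin nL → ℕ
  pointsOn ℓ = length (filterᵇ (λ p → I p ℓ) (allFin nP))

HasOrder : ProjectivePlane → ℕ → Set
HasOrder Π q = ∀ ℓ → pointsOn ℓ ≡ suc q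
  where open ProjectivePlane Π

module IncidenceGraph (Π : ProjectivePlane) where
  open ProjectivePlane Π

  Vertex : Set
  Vertex = Fin nP ⊎ Fin nL

  Adj : Vertex → Vertex → Set
  Adj (inj₁ p) (inj₁ p′) = Data.Empty.⊥ where import Data.Empty
  Adj (inj₁ p) (inj₂ ℓ)  = I p ℓ ≡ true
  Adj (inj₂ ℓ) (inj₁ p)  = I p ℓ ≡ true
  Adj (inj₂ ℓ) (inj₂ ℓ′) = Data.Empty.⊥ where import Data.Empty

  data Walk : Vertex → Vertex → ℕ → Set where
    here : ∀ {u} → Walk u u zero
    step : ∀ {u w v n} → Adj u w → Walk w v n → Walk u v (suc n)

  Dist : Vertex → Vertex → ℕ → Set
  Dist u v n = Walk u v n × (∀ m → Walk u v m → n ≤ m)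

  DistToSet : Vertex → (Vertex → Set) → ℕ → Set
  DistToSet v S n =
    (Σ Vertex λ s → S s × Walk v s n) ×
    (∀ s m → S s → Walk v s m → n ≤ m)

  -- an ordered k-partition {S_1,…,S_k}: v ∈ S_i iff c v ≡ i;
  -- surjectivity of c = all classes nonempty
  record Partition (k : ℕ) : Set where
    field
      class    : Vertex → Fin k
      nonempty : ∀ i → Σ Vertex λ v → class v ≡ i

  Class : ∀ {k} → Partition k → Fin k → Vertex → Set
  Class P i v = Partition.class P v ≡ i

  SameRep : ∀ {k} → Partition k → Vertex → Vertex → Set
  SameRep {k} P u v = ∀ (i : Fin k) (n : ℕ) →
    (DistToSet u (Class P i) n → DistToSet v (Class P i) n) ×
    (DistToSet v (Class P i) n → DistToSet u (Class P i) n)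

  Resolving : ∀ {k} → Partition k → Set
  Resolving P = ∀ u v → SameRep P u v → u ≡ v

  IsPartitionDimension : ℕ → Set
  IsPartitionDimension k =
    (Σ (Partition k) Resolving) × (∀ m → m < k → ¬ Σ (Partition m) Resolving)

-- Let S₁,…,S_k be a resolving partition.  For a point p and a class
-- S_i, the distance d(p, S_i) is 0, 1, 2 or 3, and it is determined by the
-- class of p, by whether p lies on a line of S_i, and by whether S_i
-- contains a point at all (the last fact does not depend on p).  Hence the
-- representation of a point is determined by its class together with one
-- bit per class, so a resolving k-partition separates at most k·2^k points.
-- A plane of order q has at least q(q+1) points, so q² ≤ k·2^k, and
-- elementary arithmetic turns this into q^(2B - A) ≤ 2^(kB) for large q,
-- which is the statement for ε = A/B.
module Submission where

open import Defs
open import Data.Nat using (ℕ; zero; suc; _≤_; _<_; _*_; _+_; _∸_; _^_; z≤n; s≤s)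
open import Data.Nat.Properties
  using ( ≤-refl; ≤-trans; <⇒≤; <⇒≱; ≰⇒>; _≤?_; ≤-antisym; n≤1+n; m≤n+m
        ; +-identityʳ; +-mono-≤; +-monoˡ-<; *-mono-≤; *-monoˡ-≤; *-mono-<
        ; *-cancelˡ-≤; *-distribˡ-+; [m*n]*[o*p]≡[m*o]*[n*p]; ^-distribˡ-+-*; ^-*-assoc
        ; ^-monoˡ-≤; ^-monoʳ-≤; m^n>0; ∸-monoʳ-≤; module ≤-Reasoning )
open import Data.Nat.DivMod using (_/_; _%_; m≡m%n+[m/n]*n; m%n<n)
open import Data.Fin as Fin
  using (Fin; zero; suc; cast; punchIn; combine; remQuot; funToFin; finToFun)
open import Data.Fin.Properties
  using ( cast-involutive; punchIn-injective; punchInᵢ≢i; combine-injective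
        ; combine-remQuot; finToFun-funToFin; injective⇒≤; any?; 2↔Bool )
open import Data.Bool using (Bool; true; false)
open import Data.Bool.Properties using (T-≡; _≟_)
open import Data.List using (List; _∷_; length; lookup; filterᵇ; allFin)
open import Data.List.Relation.Unary.All as All using ()
open import Data.List.Relation.Unary.Any as Any using ()
open import Data.List.Relation.Unary.Any.Properties using (lookup-index)
open import Data.List.Relation.Unary.AllPairs using (_∷_)
open import Data.List.Relation.Unary.Unique.Propositional using (Unique)
import Data.List.Relation.Unary.Unique.Propositional.Properties as Unique
open import Data.List.Membership.Propositional.Properties
  using (∈-lookup; ∈-filter⁺; ∈-filter⁻; ∈-allFin)
open import Data.Product using (Σ; _×_; _,_; proj₁; proj₂; uncurry)
open import Data.Sum using (inj₁; inj₂)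
open import Data.Sum.Properties using (inj₁-injective)
open import Data.Empty using (⊥-elim)
open import Function using (_∘_)
open import Function.Bundles using (Equivalence; Inverse)
open import Function.Definitions using (Injective)
open import Relation.Binary.PropositionalEquality
  using (_≡_; _≢_; refl; sym; trans; cong; cong₂; subst; module ≡-Reasoning)
open import Relation.Nullary using (¬_; Dec; yes; no; does)
open import Relation.Nullary.Decidable using (_×-dec_; T?)

bitsCode : ∀ {r} → (Fin r → Bool) → Fin (2 ^ r)
bitsCode bits = funToFin (Inverse.from 2↔Bool ∘ bits)

bitsCode-injective : ∀ {r} (bits bits′ : Fin r → Bool) →
  bitsCode bits ≡ bitsCode bits′ → ∀ i → bits i ≡ bits′ i
bitsCode-injective bits bits′ same i = begin
  bits i                   ≡⟨ sym (Inverse.strictlyInverseˡ 2↔Bool (bits i)) ⟩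
  toBool (fromBool (bits i))  ≡⟨ cong toBool fin-equal ⟩
  toBool (fromBool (bits′ i)) ≡⟨ Inverse.strictlyInverseˡ 2↔Bool (bits′ i) ⟩
  bits′ i                  ∎
  where
  open ≡-Reasoning
  toBool = Inverse.to 2↔Bool
  fromBool = Inverse.from 2↔Bool
  fin-equal : fromBool (bits i) ≡ fromBool (bits′ i)
  fin-equal = begin
    fromBool (bits i)                 ≡⟨ sym (finToFun-funToFin (fromBool ∘ bits) i) ⟩
    finToFun (bitsCode bits) i        ≡⟨ cong (λ c → finToFun c i) same ⟩
    finToFun (bitsCode bits′) i       ≡⟨ finToFun-funToFin (fromBool ∘ bits′) i ⟩
    fromBool (bits′ i)                ∎

uncurried-injective : ∀ {m n} {B : Set} (f : Fin m → Fin n → B) →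
  (∀ i j i′ j′ → f i j ≡ f i′ j′ → i ≡ i′ × j ≡ j′) →
  Injective _≡_ _≡_ (uncurry f ∘ remQuot {m} n)
uncurried-injective {m} {n} f f-injective {x} {y} same = begin
  x                               ≡⟨ sym (combine-remQuot {m} n x) ⟩
  uncurry combine (remQuot {m} n x)   ≡⟨ cong₂ combine (proj₁ parts) (proj₂ parts) ⟩
  uncurry combine (remQuot {m} n y)   ≡⟨ combine-remQuot {m} n y ⟩
  y                               ∎
  where
  open ≡-Reasoning
  parts = f-injective _ _ _ _ same

lookup-injective : ∀ {A : Set} {xs : List A} → Unique xs →
  ∀ i j → lookup xs i ≡ lookup xs j → i ≡ j
lookup-injective (_ ∷ _)    zero    zero    _    = refl
lookup-injective (x∉ ∷ _)   zero    (suc j) same = ⊥-elim (All.lookup x∉ (∈-lookup j) same)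
lookup-injective (x∉ ∷ _)   (suc i) zero    same = ⊥-elim (All.lookup x∉ (∈-lookup i) (sym same))
lookup-injective (_ ∷ rest) (suc i) (suc j) same = cong suc (lookup-injective rest i j same)

module Selection {n : ℕ} (f : Fin n → Bool) where

  selected : List (Fin n)
  selected = filterᵇ f (allFin n)

  selected-injective : ∀ i j → lookup selected i ≡ lookup selected j → i ≡ j
  selected-injective = lookup-injective (Unique.filter⁺ (T? ∘ f) (Unique.allFin⁺ n))

  selected-sound : ∀ i → f (lookup selected i) ≡ true
  selected-sound i = Equivalence.to T-≡ (proj₂ (∈-filter⁻ (T? ∘ f) {xs = allFin n} (∈-lookup i)))

  selected-complete : ∀ x → f x ≡ true →
    Σ (Fin (length selected)) λ i → lookup selected i ≡ x
  selected-complete x fx = Any.index x∈ , sym (lookup-index x∈)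
    where x∈ = ∈-filter⁺ (T? ∘ f) (∈-allFin x) (Equivalence.from T-≡ fx)

module PlaneFacts (Π : ProjectivePlane) where
  open ProjectivePlane Π

  joining-line-unique : ∀ {p p′ ℓ ℓ′} → p ≢ p′ →
    I p ℓ ≡ true → I p′ ℓ ≡ true → I p ℓ′ ≡ true → I p′ ℓ′ ≡ true → ℓ ≡ ℓ′
  joining-line-unique p≢p′ pℓ p′ℓ pℓ′ p′ℓ′ =
    trans (unique _ pℓ p′ℓ) (sym (unique _ pℓ′ p′ℓ′))
    where unique = proj₂ (proj₂ (line-through _ _ p≢p′))

  meeting-point-unique : ∀ {ℓ ℓ′ p p′} → ℓ ≢ ℓ′ →
    I p ℓ ≡ true → I p ℓ′ ≡ true → I p′ ℓ ≡ true → I p′ ℓ′ ≡ true → p ≡ p′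
  meeting-point-unique ℓ≢ℓ′ pℓ pℓ′ p′ℓ p′ℓ′ =
    trans (unique _ pℓ pℓ′) (sym (unique _ p′ℓ p′ℓ′))
    where unique = proj₂ (proj₂ (meet _ _ ℓ≢ℓ′))

  -- A non-incident point–line pair: the third point of the quadrangle is
  -- off the line joining the first two.
  anti-flag : Σ (Fin nP) λ p → Σ (Fin nL) λ ℓ → I p ℓ ≢ true
  anti-flag = quad v₂ , ℓ , third-off
    where
    v₀ v₁ v₂ : Fin 4
    v₀ = zero
    v₁ = suc zero
    v₂ = suc (suc zero)
    q₀≢q₁ : quad v₀ ≢ quad v₁
    q₀≢q₁ same with quad-inj same
    ... | ()
    joining = line-through (quad v₀) (quad v₁) q₀≢q₁
    ℓ = proj₁ joining
    third-off : I (quad v₂) ℓ ≢ true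
    third-off q₂ℓ = quad-gen v₀ v₁ v₂ (λ ()) (λ ()) (λ ())
      (ℓ , proj₁ (proj₁ (proj₂ joining)) , proj₂ (proj₁ (proj₂ joining)) , q₂ℓ)

module PlaneOfOrder (Π : ProjectivePlane) (q : ℕ) (order : HasOrder Π q) where
  open ProjectivePlane Π
  open PlaneFacts Π
  module OnLine (ℓ : Fin nL) = Selection (λ p → I p ℓ)

  pointOn : Fin nL → Fin (suc q) → Fin nP
  pointOn ℓ i = lookup (OnLine.selected ℓ) (cast (sym (order ℓ)) i)

  pointOn-incident : ∀ ℓ i → I (pointOn ℓ i) ℓ ≡ true
  pointOn-incident ℓ i = OnLine.selected-sound ℓ _

  pointOn-injective : ∀ ℓ i j → pointOn ℓ i ≡ pointOn ℓ j → i ≡ j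
  pointOn-injective ℓ i j same = begin
    i                                     ≡⟨ sym (cast-involutive (order ℓ) (sym (order ℓ)) i) ⟩
    cast (order ℓ) (cast (sym (order ℓ)) i) ≡⟨ cong (cast (order ℓ)) positions ⟩
    cast (order ℓ) (cast (sym (order ℓ)) j) ≡⟨ cast-involutive (order ℓ) (sym (order ℓ)) j ⟩
    j                                     ∎
    where
    open ≡-Reasoning
    positions = OnLine.selected-injective ℓ _ _ same

  pointOn-surjective : ∀ ℓ p → I p ℓ ≡ true → Σ (Fin (suc q)) λ i → pointOn ℓ i ≡ p
  pointOn-surjective ℓ p pℓ =
    cast (order ℓ) j ,
    trans (cong (lookup (OnLine.selected ℓ)) (cast-involutive (sym (order ℓ)) (order ℓ) j)) found
    where
    j = proj₁ (OnLine.selected-complete ℓ p pℓ)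
    found = proj₂ (OnLine.selected-complete ℓ p pℓ)

  -- Fix a point p₀ off a line ℓ₀.  The lines through p₀ ("spokes") are the
  -- joins of p₀ with the q + 1 points of ℓ₀, and every spoke carries q
  -- points other than p₀; these q(q + 1) points are pairwise distinct.
  p₀ : Fin nP
  p₀ = proj₁ anti-flag

  ℓ₀ : Fin nL
  ℓ₀ = proj₁ (proj₂ anti-flag)

  p₀∉ℓ₀ : I p₀ ℓ₀ ≢ true
  p₀∉ℓ₀ = proj₂ (proj₂ anti-flag)

  p₀≢base : ∀ i → p₀ ≢ pointOn ℓ₀ i
  p₀≢base i same = p₀∉ℓ₀ (subst (λ x → I x ℓ₀ ≡ true) (sym same) (pointOn-incident ℓ₀ i))

  spoke : Fin (suc q) → Fin nL
  spoke i = proj₁ (line-through p₀ (pointOn ℓ₀ i) (p₀≢base i))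

  p₀-on-spoke : ∀ i → I p₀ (spoke i) ≡ true
  p₀-on-spoke i = proj₁ (proj₁ (proj₂ (line-through p₀ (pointOn ℓ₀ i) (p₀≢base i))))

  base-on-spoke : ∀ i → I (pointOn ℓ₀ i) (spoke i) ≡ true
  base-on-spoke i = proj₂ (proj₁ (proj₂ (line-through p₀ (pointOn ℓ₀ i) (p₀≢base i))))

  -- Distinct base points give distinct spokes: a spoke meets ℓ₀ only once.
  spoke-injective : ∀ i i′ → spoke i ≡ spoke i′ → i ≡ i′
  spoke-injective i i′ same = pointOn-injective ℓ₀ i i′
    (meeting-point-unique ℓ₀≢spoke (pointOn-incident ℓ₀ i) (base-on-spoke i)
      (pointOn-incident ℓ₀ i′) (subst (λ ℓ → I (pointOn ℓ₀ i′) ℓ ≡ true) (sym same) (base-on-spoke i′)))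
    where
    ℓ₀≢spoke : ℓ₀ ≢ spoke i
    ℓ₀≢spoke e = p₀∉ℓ₀ (subst (λ ℓ → I p₀ ℓ ≡ true) (sym e) (p₀-on-spoke i))

  p₀-position : Fin (suc q) → Fin (suc q)
  p₀-position i = proj₁ (pointOn-surjective (spoke i) p₀ (p₀-on-spoke i))

  p₀-at-position : ∀ i → pointOn (spoke i) (p₀-position i) ≡ p₀
  p₀-at-position i = proj₂ (pointOn-surjective (spoke i) p₀ (p₀-on-spoke i))

  spokePoint : Fin (suc q) → Fin q → Fin nP
  spokePoint i j = pointOn (spoke i) (punchIn (p₀-position i) j)

  spokePoint≢p₀ : ∀ i j → p₀ ≢ spokePoint i j
  spokePoint≢p₀ i j same = punchInᵢ≢i (p₀-position i) j
    (pointOn-injective (spoke i) (punchIn (p₀-position i) j) (p₀-position i)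
      (trans (sym same) (sym (p₀-at-position i))))

  -- A point other than p₀ lies on only one spoke, and on it at one position.
  spokePoint-injective : ∀ i j i′ j′ → spokePoint i j ≡ spokePoint i′ j′ → i ≡ i′ × j ≡ j′
  spokePoint-injective i j i′ j′ same = i≡i′ , j≡j′
    where
    common-spoke : spoke i ≡ spoke i′
    common-spoke = joining-line-unique (spokePoint≢p₀ i j)
      (p₀-on-spoke i) (pointOn-incident (spoke i) (punchIn (p₀-position i) j))
      (p₀-on-spoke i′)
      (subst (λ x → I x (spoke i′) ≡ true) (sym same) (pointOn-incident (spoke i′) (punchIn (p₀-position i′) j′)))
    i≡i′ : i ≡ i′
    i≡i′ = spoke-injective i i′ common-spoke
    j≡j′ : j ≡ j′
    j≡j′ = punchIn-injective (p₀-position i) j j′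
      (pointOn-injective (spoke i) (punchIn (p₀-position i) j) (punchIn (p₀-position i) j′)
        (trans same (cong (λ i″ → spokePoint i″ j′) (sym i≡i′))))

  many-points : suc q * q ≤ nP
  many-points = injective⇒≤ (uncurried-injective spokePoint spokePoint-injective)

-- Assuming every line carries a point, the distance from a point p to a
-- nonempty vertex set S is 0, 1, 2 or 3, decided by whether p ∈ S, whether
-- p lies on a line of S, and whether S contains a point.
module PointDistances (Π : ProjectivePlane)
    (line-has-point : ∀ ℓ → Σ (Fin (ProjectivePlane.nP Π)) λ p → ProjectivePlane.I Π p ℓ ≡ true) where
  open ProjectivePlane Π
  open IncidenceGraph Π

  MeetsLineOf : (Vertex → Set) → Fin nP → Set
  MeetsLineOf S p = Σ (Fin nL) λ ℓ → I p ℓ ≡ true × S (inj₂ ℓ)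

  HasPoint : (Vertex → Set) → Set
  HasPoint S = Σ (Fin nP) λ x → S (inj₁ x)

  -- the distance, given the answers to the three questions above
  distanceCode : Bool → Bool → Bool → ℕ
  distanceCode true  _     _     = 0
  distanceCode false true  _     = 1
  distanceCode false false true  = 2
  distanceCode false false false = 3

  path₂ : ∀ {p x} → p ≢ x → Walk (inj₁ p) (inj₁ x) 2
  path₂ p≢x = step {w = inj₂ (proj₁ joining)} (proj₁ (proj₁ (proj₂ joining)))
                (step (proj₂ (proj₁ (proj₂ joining))) here)
    where joining = line-through _ _ p≢x

  _▷_ : ∀ {u v w n} → Walk u v n → Adj v w → Walk u w (suc n)
  here       ▷ edge = step edge here
  step e walk ▷ edge = step e (walk ▷ edge)

  -- Lower bounds: short walks from a point can only end at p itself, at a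
  -- line through p, or (after two steps) at a point.
  at-least-1 : ∀ (S : Vertex → Set) {p s m} → ¬ S (inj₁ p) → S s → Walk (inj₁ p) s m → 1 ≤ m
  at-least-1 _ p∉S s∈S here       = ⊥-elim (p∉S s∈S)
  at-least-1 _ _   _   (step _ _) = s≤s z≤n

  at-least-2 : ∀ (S : Vertex → Set) {p s m} → ¬ S (inj₁ p) → ¬ MeetsLineOf S p →
    S s → Walk (inj₁ p) s m → 2 ≤ m
  at-least-2 _ p∉S _ s∈S here                            = ⊥-elim (p∉S s∈S)
  at-least-2 _ _ _ _ (step {w = inj₁ _} () _)
  at-least-2 _ _ p∤S s∈S (step {w = inj₂ ℓ} pℓ here)     = ⊥-elim (p∤S (ℓ , pℓ , s∈S))
  at-least-2 _ _ _ _ (step {w = inj₂ _} _ (step _ _))    = s≤s (s≤s z≤n)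

  at-least-3 : ∀ (S : Vertex → Set) {p s m} → ¬ S (inj₁ p) → ¬ MeetsLineOf S p → ¬ HasPoint S →
    S s → Walk (inj₁ p) s m → 3 ≤ m
  at-least-3 _ p∉S _ _ s∈S here                                          = ⊥-elim (p∉S s∈S)
  at-least-3 _ _ _ _ _ (step {w = inj₁ _} () _)
  at-least-3 _ _ p∤S _ s∈S (step {w = inj₂ ℓ} pℓ here)                   = ⊥-elim (p∤S (ℓ , pℓ , s∈S))
  at-least-3 _ _ _ _ _ (step {w = inj₂ _} _ (step {w = inj₂ _} () _))
  at-least-3 _ _ _ no-point s∈S (step {w = inj₂ _} _ (step {w = inj₁ x} _ here)) = ⊥-elim (no-point (x , s∈S))
  at-least-3 _ _ _ _ _ (step {w = inj₂ _} _ (step {w = inj₁ _} _ (step _ _))) = s≤s (s≤s (s≤s z≤n))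

  point-distance : ∀ (S : Vertex → Set) → Σ Vertex S → ∀ p →
    (p∈S? : Dec (S (inj₁ p))) (meets? : Dec (MeetsLineOf S p)) (hasPoint? : Dec (HasPoint S)) →
    DistToSet (inj₁ p) S (distanceCode (does p∈S?) (does meets?) (does hasPoint?))
  point-distance S _ p (yes p∈S) _ _ = (inj₁ p , p∈S , here) , λ _ _ _ _ → z≤n
  point-distance S _ p (no p∉S) (yes (ℓ , pℓ , ℓ∈S)) _ =
    (inj₂ ℓ , ℓ∈S , step pℓ here) , λ _ _ → at-least-1 S p∉S
  point-distance S _ p (no p∉S) (no p∤S) (yes (x , x∈S)) =
    (inj₁ x , x∈S , path₂ p≢x) , λ _ _ → at-least-2 S p∉S p∤S
    where
    p≢x : p ≢ x
    p≢x refl = p∉S x∈S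
  -- (a nonempty S without points contains a line L, reached via a point of L)
  point-distance S (inj₁ x , x∈S) p (no _) (no _) (no no-point) = ⊥-elim (no-point (x , x∈S))
  point-distance S (inj₂ L , L∈S) p (no p∉S) (no p∤S) (no no-point) =
    (inj₂ L , L∈S , walk-to-L) , λ _ _ → at-least-3 S p∉S p∤S no-point
    where
    y = proj₁ (line-has-point L)
    p≢y : p ≢ y
    p≢y refl = p∤S (L , proj₂ (line-has-point L) , L∈S)
    walk-to-L : Walk (inj₁ p) (inj₂ L) 3
    walk-to-L = path₂ p≢y ▷ proj₂ (line-has-point L)

  distance-unique : ∀ {v S n n′} → DistToSet v S n → DistToSet v S n′ → n ≡ n′
  distance-unique ((s , s∈S , w) , least) ((s′ , s′∈S , w′) , least′) =
    ≤-antisym (least s′ _ s′∈S w′) (least′ s _ s∈S w)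

  same-distance : ∀ {u v S n₀} → DistToSet u S n₀ → DistToSet v S n₀ → ∀ n →
    (DistToSet u S n → DistToSet v S n) × (DistToSet v S n → DistToSet u S n)
  same-distance du dv n =
    (λ d → subst (DistToSet _ _) (distance-unique du d) dv) ,
    (λ d → subst (DistToSet _ _) (distance-unique dv d) du)

  -- A point's profile is its class together with the
  -- set of classes containing a line through it; a resolving k-partition
  -- makes the profile injective, so the plane has at most k·2^k points.
  module Profiles {k : ℕ} (P : Partition k) where
    class : Vertex → Fin k
    class = Partition.class P

    meets? : ∀ p i → Dec (MeetsLineOf (Class P i) p)
    meets? p i = any? λ ℓ → (I p ℓ ≟ true) ×-dec (class (inj₂ ℓ) Fin.≟ i)

    hasPoint? : ∀ i → Dec (HasPoint (Class P i))
    hasPoint? i = any? λ x → class (inj₁ x) Fin.≟ i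

    adjacency : Fin nP → Fin k → Bool
    adjacency p i = does (meets? p i)

    distance-to-class : ∀ p i →
      DistToSet (inj₁ p) (Class P i)
        (distanceCode (does (class (inj₁ p) Fin.≟ i)) (adjacency p i) (does (hasPoint? i)))
    distance-to-class p i =
      point-distance (Class P i) (Partition.nonempty P i) p (class (inj₁ p) Fin.≟ i) (meets? p i) (hasPoint? i)

    same-profile⇒same-rep : ∀ p p′ → class (inj₁ p) ≡ class (inj₁ p′) →
      (∀ i → adjacency p i ≡ adjacency p′ i) → SameRep P (inj₁ p) (inj₁ p′)
    same-profile⇒same-rep p p′ same-class same-adjacency i =
      same-distance (distance-to-class p i)
        (subst (DistToSet (inj₁ p′) (Class P i)) (sym same-code) (distance-to-class p′ i))
      where
      same-code : distanceCode (does (class (inj₁ p) Fin.≟ i)) (adjacency p i) (does (hasPoint? i))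
                ≡ distanceCode (does (class (inj₁ p′) Fin.≟ i)) (adjacency p′ i) (does (hasPoint? i))
      same-code = cong₂ (λ c b → distanceCode (does (c Fin.≟ i)) b (does (hasPoint? i)))
                    same-class (same-adjacency i)

    profile : Fin nP → Fin (k * 2 ^ k)
    profile p = combine (class (inj₁ p)) (bitsCode (adjacency p))

    points≤ : Resolving P → nP ≤ k * 2 ^ k
    points≤ resolving = injective⇒≤ profile-injective
      where
      profile-injective : Injective _≡_ _≡_ profile
      profile-injective {p} {p′} same = inj₁-injective (resolving (inj₁ p) (inj₁ p′)
        (same-profile⇒same-rep p p′ (proj₁ parts)
          (bitsCode-injective (adjacency p) (adjacency p′) (proj₂ parts))))
        where parts = combine-injective _ _ _ _ same

^-distribʳ-* : ∀ x y n → (x * y) ^ n ≡ x ^ n * y ^ n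
^-distribʳ-* x y zero    = refl
^-distribʳ-* x y (suc n) = begin
  x * y * (x * y) ^ n       ≡⟨ cong (x * y *_) (^-distribʳ-* x y n) ⟩
  x * y * (x ^ n * y ^ n)   ≡⟨ [m*n]*[o*p]≡[m*o]*[n*p] x y (x ^ n) (y ^ n) ⟩
  x * x ^ n * (y * y ^ n)   ∎
  where open ≡-Reasoning

^-double : ∀ x n → x ^ (2 * n) ≡ (x * x) ^ n
^-double x n = begin
  x ^ (2 * n)     ≡⟨ cong (λ e → x ^ (n + e)) (+-identityʳ n) ⟩
  x ^ (n + n)     ≡⟨ ^-distribˡ-+-* x n n ⟩
  x ^ n * x ^ n   ≡⟨ sym (^-distribʳ-* x x n) ⟩
  (x * x) ^ n     ∎
  where open ≡-Reasoning

n<2^n : ∀ n → n < 2 ^ n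
n<2^n zero    = s≤s z≤n
n<2^n (suc n) = subst (suc (suc n) ≤_) (cong (2 ^ n +_) (sym (+-identityʳ (2 ^ n))))
                  (+-mono-≤ (m^n>0 2 n) (n<2^n n))

-- Every polynomial is eventually dominated by 2^k: with d = 2C and
-- m = ⌊k/d⌋ ≥ d one has k < (m+1) d ≤ 2^m d, so k^C ≤ 2^(mC) d^C ≤ 2^(md) ≤ 2^k.
polynomial≤exponential : ∀ c → Σ ℕ λ K → ∀ k → K ≤ k → k ^ suc c ≤ 2 ^ k
polynomial≤exponential c = d * d , bound
  where
  C = suc c
  d = C + C
  bound : ∀ k → d * d ≤ k → k ^ C ≤ 2 ^ k
  bound k d²≤k = begin
    k ^ C                       ≤⟨ ^-monoˡ-≤ C k≤2ᵐd ⟩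
    (2 ^ m * d) ^ C             ≡⟨ ^-distribʳ-* (2 ^ m) d C ⟩
    (2 ^ m) ^ C * d ^ C         ≤⟨ *-mono-≤ (≤-refl {(2 ^ m) ^ C}) (^-monoˡ-≤ C d≤2ᵐ) ⟩
    (2 ^ m) ^ C * (2 ^ m) ^ C   ≡⟨ cong₂ _*_ (^-*-assoc 2 m C) (^-*-assoc 2 m C) ⟩
    2 ^ (m * C) * 2 ^ (m * C)   ≡⟨ sym (^-distribˡ-+-* 2 (m * C) (m * C)) ⟩
    2 ^ (m * C + m * C)         ≡⟨ cong (2 ^_) (sym (*-distribˡ-+ m C C)) ⟩
    2 ^ (m * d)                 ≤⟨ ^-monoʳ-≤ 2 md≤k ⟩
    2 ^ k                       ∎
    where
    open ≤-Reasoning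
    m = k / d
    k≡ : k ≡ k % d + m * d
    k≡ = m≡m%n+[m/n]*n k d
    md≤k : m * d ≤ k
    md≤k = subst (m * d ≤_) (sym k≡) (m≤n+m (m * d) (k % d))
    k<[m+1]d : k < suc m * d
    k<[m+1]d = subst (_< suc m * d) (sym k≡) (+-monoˡ-< (m * d) (m%n<n k d))
    k≤2ᵐd : k ≤ 2 ^ m * d
    k≤2ᵐd = ≤-trans (<⇒≤ k<[m+1]d) (*-monoˡ-≤ d (n<2^n m))
    d≤m : d ≤ m
    d≤m with d ≤? m
    ... | yes d≤m = d≤m
    ... | no d≰m  = ⊥-elim (<⇒≱ (≤-trans k<[m+1]d (*-monoˡ-≤ d (≰⇒> d≰m))) d²≤k)
    d≤2ᵐ : d ≤ 2 ^ m
    d≤2ᵐ = ≤-trans d≤m (<⇒≤ (n<2^n m))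

bound-when-k-small : ∀ B q k → k ^ B ≤ q → q * q ≤ k * 2 ^ k → q ^ (2 * B) ≤ q * 2 ^ (k * B)
bound-when-k-small B q k kᴮ≤q q²≤k2ᵏ = begin
  q ^ (2 * B)           ≡⟨ ^-double q B ⟩
  (q * q) ^ B           ≤⟨ ^-monoˡ-≤ B q²≤k2ᵏ ⟩
  (k * 2 ^ k) ^ B       ≡⟨ ^-distribʳ-* k (2 ^ k) B ⟩
  k ^ B * (2 ^ k) ^ B   ≡⟨ cong (k ^ B *_) (^-*-assoc 2 k B) ⟩
  k ^ B * 2 ^ (k * B)   ≤⟨ *-monoˡ-≤ (2 ^ (k * B)) kᴮ≤q ⟩
  q * 2 ^ (k * B)       ∎
  where open ≤-Reasoning

bound-when-q-small : ∀ B q k → q * q ≤ 2 ^ k → q ^ (2 * B) ≤ 2 ^ (k * B)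
bound-when-q-small B q k q²≤2ᵏ = begin
  q ^ (2 * B)   ≡⟨ ^-double q B ⟩
  (q * q) ^ B   ≤⟨ ^-monoˡ-≤ B q²≤2ᵏ ⟩
  (2 ^ k) ^ B   ≡⟨ ^-*-assoc 2 k B ⟩
  2 ^ (k * B)   ∎
  where open ≤-Reasoning

-- For ε = A/B with A = a+1, B = b+1:  q² ≤ k 2^k implies
-- q^(2B - A) ≤ 2^(kB), i.e. k ≥ (2 - ε) log₂ q, once q > K^B, where
-- K bounds the range in which k^(2B) may exceed 2^k.  If k^B ≤ q the first
-- case gives q^(2B-1) ≤ 2^(kB); otherwise q < k^B forces k ≥ K, so
-- q² < k^(2B) ≤ 2^k and the second case applies.
logarithmic-bound : ∀ a b → Σ ℕ λ q₀ → ∀ q k → q₀ ≤ q → q * q ≤ k * 2 ^ k →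
  q ^ (2 * suc b ∸ suc a) ≤ 2 ^ (k * suc b)
logarithmic-bound a b = suc (K ^ B) , bound
  where
  B = suc b
  -- 2B = suc (2B ∸ 1) by computation, so this is the bound for k^(2B)
  K = proj₁ (polynomial≤exponential (2 * B ∸ 1))
  k²ᴮ≤2ᵏ : ∀ k → K ≤ k → k ^ (2 * B) ≤ 2 ^ k
  k²ᴮ≤2ᵏ = proj₂ (polynomial≤exponential (2 * B ∸ 1))

  bound : ∀ q k → suc (K ^ B) ≤ q → q * q ≤ k * 2 ^ k → q ^ (2 * B ∸ suc a) ≤ 2 ^ (k * B)
  bound q@(suc _) k q₀≤q q²≤k2ᵏ =
    ≤-trans (^-monoʳ-≤ q (∸-monoʳ-≤ {m = 1} {n = suc a} (2 * B) (s≤s z≤n))) q²ᴮ⁻¹≤2ᵏᴮ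
    where
    q²ᴮ⁻¹≤2ᵏᴮ : q ^ (2 * B ∸ 1) ≤ 2 ^ (k * B)
    q²ᴮ⁻¹≤2ᵏᴮ with k ^ B ≤? q
    -- q^(2B) is q · q^(2B ∸ 1) by computation, so we may cancel one factor q
    ... | yes kᴮ≤q = *-cancelˡ-≤ q (bound-when-k-small B q k kᴮ≤q q²≤k2ᵏ)
    ... | no kᴮ≰q  = ≤-trans (^-monoʳ-≤ q (n≤1+n (2 * B ∸ 1))) (bound-when-q-small B q k q²≤2ᵏ)
      where
      q<kᴮ : q < k ^ B
      q<kᴮ = ≰⇒> kᴮ≰q
      K≤k : K ≤ k
      K≤k with K ≤? k
      ... | yes K≤k = K≤k
      ... | no K≰k  = ⊥-elim (<⇒≱ (≤-trans q<kᴮ (^-monoˡ-≤ B (<⇒≤ (≰⇒> K≰k)))) (≤-trans (n≤1+n _) q₀≤q))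
      q²≤2ᵏ : q * q ≤ 2 ^ k
      q²≤2ᵏ = begin
        q * q           ≤⟨ <⇒≤ (*-mono-< q<kᴮ q<kᴮ) ⟩
        k ^ B * k ^ B   ≡⟨ sym (^-distribʳ-* k k B) ⟩
        (k * k) ^ B     ≡⟨ sym (^-double k B) ⟩
        k ^ (2 * B)     ≤⟨ k²ᴮ≤2ᵏ k K≤k ⟩
        2 ^ k           ∎
        where open ≤-Reasoning

theorem2 : ∀ (a b : ℕ) → Σ ℕ λ q₀ → ∀ (q : ℕ) → q₀ ≤ q →
    ∀ (Π : ProjectivePlane) → HasOrder Π q →
    ∀ (k : ℕ) → IncidenceGraph.IsPartitionDimension Π k →
    q ^ (2 * suc b ∸ suc a) ≤ 2 ^ (k * suc b)
theorem2 a b = proj₁ (logarithmic-bound a b) , λ q q₀≤q Π order k ((P , resolving) , _) →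
  let open PlaneOfOrder Π q order using (many-points; pointOn; pointOn-incident)
      open PointDistances Π (λ ℓ → pointOn ℓ zero , pointOn-incident ℓ zero)
      q²≤k2ᵏ : q * q ≤ k * 2 ^ k
      q²≤k2ᵏ = ≤-trans (*-monoˡ-≤ q (n≤1+n q))
                 (≤-trans many-points (Profiles.points≤ P resolving))
  in proj₂ (logarithmic-bound a b) q k q₀≤q q²≤k2ᵏ
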